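{- (1) The following two statements are equivalent: (i) for every integer $k\ge1$ and every $t\in\{1,\ldots,2^k-2\}$, $\lvert S_{t,k}\rvert\le 2^{k-1}$; (ii) for every integer $k\ge1$ and every $t\in\{1,\ldots,2^k-2\}$, \[\bigl\lvert\{n\in\{0,\ldots,2^k-1\}: w(n\oplus_k t)\ge w(n)\}\bigr\rvert\ge 2^{k-1}.\] (2) The following two statements are equivalent: (iii) for every nonnegative integer $t$, $c_t>1/2$; (iv) for all integers $k,t\ge1$, \[\bigl\lvert\{n\in\{0,\ldots,2^k-1\}: w(n+t)\ge w(n)\}\bigr\rvert> 2^{k-1}.\]
   Context: For a nonnegative integer $n$, $w(n)$ denotes the number of $1$s in the binary expansion of $n$. For integers $k\ge1$ and $a,b$, $a\oplus_k b=(a+b)\bmod (2^k-1)$ (the least nonnegative residue). For $k\ge1$ and $t\in\{1,\ldots,2^k-2\}$, $S_{t,k}=\{(a,b)\in\{0,\ldots,2^k-2\}^2: a+b\equiv t \pmod{2^k-1},\ w(a)+w(b)<k\}$. For a nonnegative integer $t$, $c_t$ denotes the asymptotic density of $\{n\in\mathbb N: w(n+t)\ge w(n)\}$ (which exists). -}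

module Defs where

open import Data.Nat using (ℕ; zero; suc; _+_; _*_; _∸_; _^_; _≤_; _<_; _≥_; _>_; _≤?_; _<?_)
open import Data.Nat.DivMod using (_%_; _/_)
open import Data.Nat.Properties using (_≟_)
open import Data.List using (List; length; filter; upTo; cartesianProduct)
open import Data.Product using (Σ; ∃; _×_; _,_; proj₁; proj₂)
open import Relation.Nullary.Decidable using (_×-dec_)
open import Relation.Binary.PropositionalEquality using (_≡_)

-- number of 1s in the binary expansion (fuel n suffices since n halves each step)
wAux : ℕ → ℕ → ℕ
wAux zero    n = 0
wAux (suc f) n = n % 2 + wAux f (n / 2)

w : ℕ → ℕ
w n = wAux n n

M : ℕ → ℕ
M k = 2 ^ k ∸ 1

-- least nonnegative residue of a modulo m (only used with m ≥ 1)
modℕ : ℕ → ℕ → ℕ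
modℕ a zero    = a
modℕ a (suc m) = a % suc m

⊕ : ℕ → ℕ → ℕ → ℕ
⊕ k a b = modℕ (a + b) (M k)

-- |S_{t,k}|: pairs (a,b) ∈ {0,…,2^k-2}², a+b ≡ t (mod 2^k-1), w(a)+w(b) < k
-- (for 1 ≤ t ≤ 2^k-2, a+b ≡ t mod 2^k-1 iff (a+b) mod (2^k-1) = t)
sizeS : ℕ → ℕ → ℕ
sizeS t k = length (filter (λ p → (modℕ (proj₁ p + proj₂ p) (M k) ≟ t)
                                   ×-dec (w (proj₁ p) + w (proj₂ p) <? k))
                           (cartesianProduct (upTo (M k)) (upTo (M k))))

countCirc : ℕ → ℕ → ℕ
countCirc t k = length (filter (λ n → w n ≤? w (⊕ k n t)) (upTo (2 ^ k)))

countBelow : ℕ → ℕ → ℕ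
countBelow t N = length (filter (λ n → w n ≤? w (n + t)) (upTo N))

StmtI : Set
StmtI = (k : ℕ) → k ≥ 1 → (t : ℕ) → 1 ≤ t → t ≤ 2 ^ k ∸ 2 → sizeS t k ≤ 2 ^ (k ∸ 1)

StmtII : Set
StmtII = (k : ℕ) → k ≥ 1 → (t : ℕ) → 1 ≤ t → t ≤ 2 ^ k ∸ 2 → countCirc t k ≥ 2 ^ (k ∸ 1)

-- c_t > 1/2, where c_t = lim_{N→∞} countBelow t N / N (which exists).
-- Since the limit exists, c_t > 1/2 iff there is a rational a/b > 1/2 with
-- countBelow t N / N ≥ a/b for all sufficiently large N.
DensityGtHalf : ℕ → Set
DensityGtHalf t = Σ ℕ λ a → Σ ℕ λ b → (2 * a > b) × (Σ ℕ λ N₀ → (N : ℕ) → N ≥ N₀ → b * countBelow t N ≥ a * N)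

StmtIII : Set
StmtIII = (t : ℕ) → DensityGtHalf t

StmtIV : Set
StmtIV = (k t : ℕ) → k ≥ 1 → t ≥ 1 → countBelow t (2 ^ k) > 2 ^ (k ∸ 1)

module Submission where

-- Part (1) rests on the identity |S_{t,k}| + countCirc t k = 2^k (complement-count). For
-- 1 ≤ n ≤ 2^k − 1, a = 2^k − 1 − n is the k-bit complement of n, so w(a) + w(n) = k, and the
-- unique b with a + b ≡ t is n ⊕ t; thus (a, b) ∈ S_{t,k} exactly when w(n ⊕ t) < w(n), while
-- n = 0 always counts. Hence one count is ≤ 2^{k−1} iff the other is ≥ 2^{k−1}.
--
-- Part (2), (iii) ⇒ (iv): no block [q·2^k, (q+1)·2^k) contains more counted n than [0, 2^k)
-- (block-count-bound), so a density above 1/2 forces a majority in [0, 2^k).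
-- (iv) ⇒ (iii): in blocks of length P = 2^t > t, adding t carries at most once into the block
-- number q, and the effect of the carry depends only on the trailing ones of q (CarryAnalysis).
-- An averaging lemma for such block sequences (TrailingOnes) shows that every initial run of
-- blocks does at least as well on average as the first 2^{P+1} blocks, which beat P/2 by (iv);
-- density-from-blocks turns this into c_t > 1/2.

open import Defs
open import Data.Nat hiding (parity)
open import Data.Nat.Properties
open import Data.Nat.DivMod
open import Data.Nat.Divisibility using (n∣m*n)
open import Data.Nat.Induction using (<-rec)
open import Data.Nat.ListAction using (sum)
open import Data.Nat.ListAction.Properties using (sum-++)
open import Data.Nat.Tactic.RingSolver using (solve-∀)
open import Data.List using (List; []; _∷_; _++_; map; length; filter; applyUpTo; upTo; cartesianProduct)
open import Data.List.Properties using (map-++; map-∘)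
open import Data.Product using (_×_; _,_; proj₁; proj₂)
open import Relation.Nullary.Decidable using (_×-dec_)
open import Function using (_∘_; id)
open import Function.Bundles using (_⇔_; mk⇔; Equivalence)
open import Function.Properties.Equivalence using () renaming (refl to ⇔-refl; sym to ⇔-sym; trans to ⇔-trans)
open import Relation.Binary.PropositionalEquality
open import Relation.Nullary using (¬_; Dec; yes; no; contradiction)
open import Relation.Unary using (Decidable)

𝟙 : ∀ {p} {P : Set p} → Dec P → ℕ
𝟙 (yes _) = 1
𝟙 (no _)  = 0

𝟙-cong : ∀ {p q} {P : Set p} {Q : Set q} (P? : Dec P) (Q? : Dec Q) → P ⇔ Q → 𝟙 P? ≡ 𝟙 Q?
𝟙-cong (yes _) (yes _) P⇔Q = refl
𝟙-cong (yes p) (no ¬q) P⇔Q = contradiction (Equivalence.to P⇔Q p) ¬q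
𝟙-cong (no ¬p) (yes q) P⇔Q = contradiction (Equivalence.from P⇔Q q) ¬p
𝟙-cong (no _)  (no _)  P⇔Q = refl

𝟙-mono : ∀ {p q} {P : Set p} {Q : Set q} (P? : Dec P) (Q? : Dec Q) → (P → Q) → 𝟙 P? ≤ 𝟙 Q?
𝟙-mono (yes _) (yes _) P⇒Q = ≤-refl
𝟙-mono (yes p) (no ¬q) P⇒Q = contradiction (P⇒Q p) ¬q
𝟙-mono (no _)  _       P⇒Q = z≤n

𝟙-yes : ∀ {p} {P : Set p} (P? : Dec P) → P → 𝟙 P? ≡ 1
𝟙-yes (yes _) _ = refl
𝟙-yes (no ¬p) p = contradiction p ¬p

𝟙-no : ∀ {p} {P : Set p} (P? : Dec P) → ¬ P → 𝟙 P? ≡ 0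
𝟙-no (yes p) ¬p = contradiction p ¬p
𝟙-no (no _)  _  = refl

𝟙-compl : ∀ {p q} {P : Set p} {Q : Set q} (P? : Dec P) (Q? : Dec Q) → P ⇔ (¬ Q) → 𝟙 P? + 𝟙 Q? ≡ 1
𝟙-compl (yes p) (yes q) P⇔¬Q = contradiction q (Equivalence.to P⇔¬Q p)
𝟙-compl (yes _) (no _)  P⇔¬Q = refl
𝟙-compl (no _)  (yes _) P⇔¬Q = refl
𝟙-compl (no ¬p) (no ¬q) P⇔¬Q = contradiction (Equivalence.from P⇔¬Q ¬q) ¬p

∑ : ℕ → (ℕ → ℕ) → ℕ
∑ zero    f = 0
∑ (suc n) f = f 0 + ∑ n (f ∘ suc)

syntax ∑ n (λ i → e) = ∑[ i < n ] e

∑-cong : ∀ n {f g : ℕ → ℕ} → (∀ i → i < n → f i ≡ g i) → ∑ n f ≡ ∑ n g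
∑-cong zero    f≡g = refl
∑-cong (suc n) f≡g = cong₂ _+_ (f≡g 0 z<s) (∑-cong n (λ i i<n → f≡g (suc i) (s<s i<n)))

∑-mono : ∀ n {f g : ℕ → ℕ} → (∀ i → i < n → f i ≤ g i) → ∑ n f ≤ ∑ n g
∑-mono zero    f≤g = z≤n
∑-mono (suc n) f≤g = +-mono-≤ (f≤g 0 z<s) (∑-mono n (λ i i<n → f≤g (suc i) (s<s i<n)))

∑-const : ∀ n c → ∑[ i < n ] c ≡ n * c
∑-const zero    c = refl
∑-const (suc n) c = cong (c +_) (∑-const n c)

∑-+ : ∀ n (f g : ℕ → ℕ) → ∑[ i < n ] (f i + g i) ≡ ∑ n f + ∑ n g
∑-+ zero    f g = refl
∑-+ (suc n) f g = trans (cong (f 0 + g 0 +_) (∑-+ n (f ∘ suc) (g ∘ suc))) (interchange (f 0) (g 0) _ _)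
  where
  interchange : ∀ a b c d → a + b + (c + d) ≡ a + c + (b + d)
  interchange = solve-∀

∑-split : ∀ m n (f : ℕ → ℕ) → ∑ (m + n) f ≡ ∑ m f + ∑[ i < n ] f (m + i)
∑-split zero    n f = refl
∑-split (suc m) n f = trans (cong (f 0 +_) (∑-split m n (f ∘ suc))) (sym (+-assoc (f 0) _ _))

∑-prefix : ∀ m n (f : ℕ → ℕ) → ∑ m f ≤ ∑ (m + n) f
∑-prefix m n f = ≤-trans (m≤m+n (∑ m f) _) (≤-reflexive (sym (∑-split m n f)))

∑-blocks : ∀ Q P (f : ℕ → ℕ) → ∑ (Q * P) f ≡ ∑[ q < Q ] ∑[ r < P ] f (q * P + r)
∑-blocks zero    P f = refl
∑-blocks (suc Q) P f = trans (∑-split P (Q * P) f) (cong (∑ P f +_) (trans (∑-blocks Q P (λ i → f (P + i)))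
  (∑-cong Q (λ q _ → ∑-cong P (λ r _ → cong f (sym (+-assoc P (q * P) r)))))))

∑-snoc : ∀ n (f : ℕ → ℕ) → ∑ (suc n) f ≡ ∑ n f + f n
∑-snoc zero    f = +-identityʳ (f 0)
∑-snoc (suc n) f = trans (cong (f 0 +_) (∑-snoc n (f ∘ suc))) (sym (+-assoc (f 0) _ _))

∑-reverse : ∀ n (f : ℕ → ℕ) → ∑ n f ≡ ∑[ i < n ] f (n ∸ suc i)
∑-reverse zero    f = refl
∑-reverse (suc n) f = begin
  f 0 + ∑ n (f ∘ suc)                           ≡⟨ cong (f 0 +_) (∑-reverse n (f ∘ suc)) ⟩
  f 0 + ∑[ i < n ] f (suc (n ∸ suc i))          ≡⟨ +-comm (f 0) _ ⟩
  ∑[ i < n ] f (suc (n ∸ suc i)) + f 0          ≡⟨ cong₂ _+_ (∑-cong n (λ i i<n → cong f (sym (+-∸-assoc 1 i<n))))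
                                                              (cong f (sym (n∸n≡0 n))) ⟩
  ∑[ i < n ] f (suc n ∸ suc i) + f (suc n ∸ suc n) ≡⟨ sym (∑-snoc n (λ i → f (suc n ∸ suc i))) ⟩
  ∑[ i < suc n ] f (suc n ∸ suc i)              ∎
  where open ≡-Reasoning

∑-single : ∀ n c (f : ℕ → ℕ) → c < n → (∀ i → i < n → i ≢ c → f i ≡ 0) → ∑ n f ≡ f c
∑-single (suc n) zero f _ others = begin
  f 0 + ∑ n (f ∘ suc)    ≡⟨ cong (f 0 +_) (∑-cong n (λ i i<n → others (suc i) (s<s i<n) λ ())) ⟩
  f 0 + ∑[ i < n ] 0     ≡⟨ cong (f 0 +_) (trans (∑-const n 0) (*-zeroʳ n)) ⟩
  f 0 + 0                ≡⟨ +-identityʳ (f 0) ⟩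
  f 0                    ∎
  where open ≡-Reasoning
∑-single (suc n) (suc c) f (s<s c<n) others =
  trans (cong (_+ ∑ n (f ∘ suc)) (others 0 z<s λ ()))
        (∑-single n c (f ∘ suc) c<n (λ i i<n i≢c → others (suc i) (s<s i<n) (i≢c ∘ suc-injective)))

∑-parity : ∀ Q (f : ℕ → ℕ) → ∑ (2 * Q) f ≡ ∑[ q < Q ] f (2 * q) + ∑[ q < Q ] f (suc (2 * q))
∑-parity zero    f = refl
∑-parity (suc Q) f = begin
  ∑ (2 * suc Q) f
    ≡⟨ cong (λ n → ∑ n f) (2[1+q] Q) ⟩
  f 0 + (f 1 + ∑ (2 * Q) (f ∘ suc ∘ suc))
    ≡⟨ cong (λ s → f 0 + (f 1 + s)) (∑-parity Q (f ∘ suc ∘ suc)) ⟩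
  f 0 + (f 1 + (∑[ q < Q ] f (suc (suc (2 * q))) + ∑[ q < Q ] f (suc (suc (suc (2 * q))))))
    ≡⟨ cong₂ (λ a b → f 0 + (f 1 + (a + b))) (∑-cong Q (λ q _ → cong f (sym (2[1+q] q))))
                                               (∑-cong Q (λ q _ → cong (f ∘ suc) (sym (2[1+q] q)))) ⟩
  f 0 + (f 1 + (∑[ q < Q ] f (2 * suc q) + ∑[ q < Q ] f (suc (2 * suc q))))
    ≡⟨ interchange (f 0) (f 1) _ _ ⟩
  (f 0 + ∑[ q < Q ] f (2 * suc q)) + (f 1 + ∑[ q < Q ] f (suc (2 * suc q))) ∎
  where
  open ≡-Reasoning
  2[1+q] : ∀ q → 2 * suc q ≡ suc (suc (2 * q))
  2[1+q] = solve-∀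
  interchange : ∀ a b c d → a + (b + (c + d)) ≡ (a + c) + (b + d)
  interchange = solve-∀

count-as-sum : ∀ {a p} {A : Set a} {P : A → Set p} (P? : Decidable P) (xs : List A) →
               length (filter P? xs) ≡ sum (map (𝟙 ∘ P?) xs)
count-as-sum P? []       = refl
count-as-sum P? (x ∷ xs) with P? x
... | yes _ = cong suc (count-as-sum P? xs)
... | no  _ = count-as-sum P? xs

sum-upTo : ∀ n (h : ℕ → ℕ) → sum (map h (upTo n)) ≡ ∑ n h
sum-upTo n h = go n h id
  where
  go : ∀ n (h f : ℕ → ℕ) → sum (map h (applyUpTo f n)) ≡ ∑[ i < n ] h (f i)
  go zero    h f = refl
  go (suc n) h f = cong (h (f 0) +_) (go n h (f ∘ suc))

sum-product : ∀ {a b} {A : Set a} {B : Set b} (h : A × B → ℕ) (xs : List A) (ys : List B) →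
              sum (map h (cartesianProduct xs ys)) ≡ sum (map (λ x → sum (map (λ y → h (x , y)) ys)) xs)
sum-product h []       ys = refl
sum-product h (x ∷ xs) ys = begin
  sum (map h (map (x ,_) ys ++ cartesianProduct xs ys))
    ≡⟨ cong sum (map-++ h (map (x ,_) ys) _) ⟩
  sum (map h (map (x ,_) ys) ++ map h (cartesianProduct xs ys))
    ≡⟨ sum-++ (map h (map (x ,_) ys)) _ ⟩
  sum (map h (map (x ,_) ys)) + sum (map h (cartesianProduct xs ys))
    ≡⟨ cong₂ _+_ (cong sum (sym (map-∘ ys))) (sum-product h xs ys) ⟩
  sum (map (λ y → h (x , y)) ys) + sum (map (λ x → sum (map (λ y → h (x , y)) ys)) xs) ∎
  where open ≡-Reasoning

count-upTo : ∀ {p} {P : ℕ → Set p} (P? : Decidable P) n → length (filter P? (upTo n)) ≡ ∑[ i < n ] 𝟙 (P? i)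
count-upTo P? n = trans (count-as-sum P? (upTo n)) (sum-upTo n (𝟙 ∘ P?))

count-grid : ∀ {p} {P : ℕ × ℕ → Set p} (P? : Decidable P) m n →
             length (filter P? (cartesianProduct (upTo m) (upTo n))) ≡ ∑[ a < m ] ∑[ b < n ] 𝟙 (P? (a , b))
count-grid P? m n = begin
  length (filter P? (cartesianProduct (upTo m) (upTo n)))         ≡⟨ count-as-sum P? (cartesianProduct (upTo m) (upTo n)) ⟩
  sum (map (𝟙 ∘ P?) (cartesianProduct (upTo m) (upTo n)))         ≡⟨ sum-product (𝟙 ∘ P?) (upTo m) (upTo n) ⟩
  sum (map (λ a → sum (map (λ b → 𝟙 (P? (a , b))) (upTo n))) (upTo m))
    ≡⟨ sum-upTo m _ ⟩
  ∑[ a < m ] sum (map (λ b → 𝟙 (P? (a , b))) (upTo n))            ≡⟨ ∑-cong m (λ a _ → sum-upTo n _) ⟩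
  ∑[ a < m ] ∑[ b < n ] 𝟙 (P? (a , b))                           ∎
  where open ≡-Reasoning

data Parity : ℕ → Set where
  even : ∀ x → Parity (2 * x)
  odd  : ∀ x → Parity (suc (2 * x))

parity : ∀ n → Parity n
parity zero = even 0
parity (suc n) with parity n
... | even x = odd x
... | odd  x = subst Parity (2[1+x] x) (even (suc x))
  where
  2[1+x] : ∀ x → 2 * suc x ≡ suc (suc (2 * x))
  2[1+x] = solve-∀

binary-ind : ∀ {ℓ} (P : ℕ → Set ℓ) → P 0 → (∀ x → P x → P (2 * x)) → (∀ x → P x → P (suc (2 * x))) →
             ∀ n → P n
binary-ind P base step-even step-odd = <-rec P step
  where
  step : ∀ n → (∀ {m} → m < n → P m) → P n
  step n rec with parity n
  ... | even zero    = base
  ... | even (suc x) = step-even (suc x) (rec (m<m+n (suc x) z<s))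
  ... | odd x        = step-odd x (rec (s≤s (m≤m+n x (x + 0))))

wAux-fuel : ∀ f g n → n ≤ f → n ≤ g → wAux f n ≡ wAux g n
wAux-fuel f       g       zero    _   _   = trans (wAux-zero f) (sym (wAux-zero g))
  where
  wAux-zero : ∀ f → wAux f 0 ≡ 0
  wAux-zero zero    = refl
  wAux-zero (suc f) = wAux-zero f
wAux-fuel (suc f) (suc g) (suc n) n<f n<g =
  cong (suc n % 2 +_) (wAux-fuel f g (suc n / 2) (halve n<f) (halve n<g))
  where
  halve : ∀ {f} → suc n ≤ suc f → suc n / 2 ≤ f
  halve (s≤s n≤f) = ≤-trans (≤-pred (m/n<m (suc n) 2 (s≤s (s≤s z≤n)))) n≤f

w-rec : ∀ n → w n ≡ n % 2 + w (n / 2)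
w-rec zero    = refl
w-rec (suc n) = cong (suc n % 2 +_)
  (wAux-fuel n (suc n / 2) (suc n / 2) (≤-pred (m/n<m (suc n) 2 (s≤s (s≤s z≤n)))) ≤-refl)

w-even : ∀ x → w (2 * x) ≡ w x
w-even x = begin
  w (2 * x)                   ≡⟨ cong w (*-comm 2 x) ⟩
  w (x * 2)                   ≡⟨ w-rec (x * 2) ⟩
  x * 2 % 2 + w (x * 2 / 2)   ≡⟨ cong₂ _+_ (m*n%n≡0 x 2) (cong w (m*n/n≡m x 2)) ⟩
  w x                         ∎
  where open ≡-Reasoning

w-odd : ∀ x → w (suc (2 * x)) ≡ suc (w x)
w-odd x = begin
  w (suc (2 * x))                        ≡⟨ cong (w ∘ suc) (*-comm 2 x) ⟩
  w (1 + x * 2)                          ≡⟨ w-rec (1 + x * 2) ⟩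
  (1 + x * 2) % 2 + w ((1 + x * 2) / 2)  ≡⟨ cong₂ _+_ ([m+kn]%n≡m%n 1 x 2)
                                                     (cong w (trans (+-distrib-/-∣ʳ 1 {d = 2} (n∣m*n x)) (m*n/n≡m x 2))) ⟩
  suc (w x)                              ∎
  where open ≡-Reasoning

w-suc : ∀ x → w (suc x) ≤ suc (w x)
w-suc = binary-ind _ ≤-refl step-even step-odd
  where
  open ≤-Reasoning
  step-even : ∀ x → w (suc x) ≤ suc (w x) → w (suc (2 * x)) ≤ suc (w (2 * x))
  step-even x _ = ≤-reflexive (trans (w-odd x) (cong suc (sym (w-even x))))
  step-odd : ∀ x → w (suc x) ≤ suc (w x) → w (suc (suc (2 * x))) ≤ suc (w (suc (2 * x)))
  step-odd x ih = begin
    w (suc (suc (2 * x)))  ≡⟨ cong w (2[1+x] x) ⟩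
    w (2 * suc x)          ≡⟨ w-even (suc x) ⟩
    w (suc x)              ≤⟨ ih ⟩
    suc (w x)              ≤⟨ n≤1+n _ ⟩
    suc (suc (w x))        ≡⟨ cong suc (sym (w-odd x)) ⟩
    suc (w (suc (2 * x)))  ∎
    where
    2[1+x] : ∀ x → suc (suc (2 * x)) ≡ 2 * suc x
    2[1+x] = solve-∀

w≤id : ∀ x → w x ≤ x
w≤id zero    = z≤n
w≤id (suc x) = ≤-trans (w-suc x) (s≤s (w≤id x))

w-subadditive : ∀ a b → w (a + b) ≤ w a + w b
w-subadditive = binary-ind _ (λ b → ≤-refl) step-even step-odd
  where
  open ≤-Reasoning
  step-even : ∀ x → (∀ b → w (x + b) ≤ w x + w b) → ∀ b → w (2 * x + b) ≤ w (2 * x) + w b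
  step-even x ih b with parity b
  ... | even y = begin
    w (2 * x + 2 * y)        ≡⟨ cong w (sym (*-distribˡ-+ 2 x y)) ⟩
    w (2 * (x + y))          ≡⟨ w-even (x + y) ⟩
    w (x + y)                ≤⟨ ih y ⟩
    w x + w y                ≡⟨ sym (cong₂ _+_ (w-even x) (w-even y)) ⟩
    w (2 * x) + w (2 * y)    ∎
  ... | odd y = begin
    w (2 * x + suc (2 * y))  ≡⟨ cong w (+-suc (2 * x) (2 * y)) ⟩
    w (suc (2 * x + 2 * y))  ≡⟨ cong (w ∘ suc) (sym (*-distribˡ-+ 2 x y)) ⟩
    w (suc (2 * (x + y)))    ≡⟨ w-odd (x + y) ⟩
    suc (w (x + y))          ≤⟨ s≤s (ih y) ⟩
    suc (w x + w y)          ≡⟨ sym (+-suc (w x) (w y)) ⟩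
    w x + suc (w y)          ≡⟨ sym (cong₂ _+_ (w-even x) (w-odd y)) ⟩
    w (2 * x) + w (suc (2 * y)) ∎
  step-odd : ∀ x → (∀ b → w (x + b) ≤ w x + w b) → ∀ b → w (suc (2 * x) + b) ≤ w (suc (2 * x)) + w b
  step-odd x ih b with parity b
  ... | even y = begin
    w (suc (2 * x + 2 * y))  ≡⟨ cong (w ∘ suc) (sym (*-distribˡ-+ 2 x y)) ⟩
    w (suc (2 * (x + y)))    ≡⟨ w-odd (x + y) ⟩
    suc (w (x + y))          ≤⟨ s≤s (ih y) ⟩
    suc (w x + w y)          ≡⟨ sym (cong₂ _+_ (w-odd x) (w-even y)) ⟩
    w (suc (2 * x)) + w (2 * y) ∎
  ... | odd y = begin
    w (suc (2 * x + suc (2 * y)))  ≡⟨ cong w (carry x y) ⟩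
    w (2 * (x + suc y))            ≡⟨ w-even (x + suc y) ⟩
    w (x + suc y)                  ≤⟨ ih (suc y) ⟩
    w x + w (suc y)                ≤⟨ +-mono-≤ (n≤1+n (w x)) (w-suc y) ⟩
    suc (w x) + suc (w y)          ≡⟨ sym (cong₂ _+_ (w-odd x) (w-odd y)) ⟩
    w (suc (2 * x)) + w (suc (2 * y)) ∎
    where
    carry : ∀ x y → suc (2 * x + suc (2 * y)) ≡ 2 * (x + suc y)
    carry = solve-∀

w-concat : ∀ m x y → y < 2 ^ m → w (x * 2 ^ m + y) ≡ w x + w y
w-concat zero    x zero    _        = trans (cong w (trans (+-identityʳ (x * 1)) (*-identityʳ x))) (sym (+-identityʳ (w x)))
w-concat zero    x (suc y) (s≤s ())
w-concat (suc m) x y y<2P with parity y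
... | even y′ = begin
  w (x * 2 ^ suc m + 2 * y′)  ≡⟨ cong w (shift x (2 ^ m) y′) ⟩
  w (2 * (x * 2 ^ m + y′))    ≡⟨ w-even (x * 2 ^ m + y′) ⟩
  w (x * 2 ^ m + y′)          ≡⟨ w-concat m x y′ (*-cancelˡ-< 2 y′ (2 ^ m) y<2P) ⟩
  w x + w y′                  ≡⟨ cong (w x +_) (sym (w-even y′)) ⟩
  w x + w (2 * y′)            ∎
  where
  open ≡-Reasoning
  shift : ∀ x P y → x * (2 * P) + 2 * y ≡ 2 * (x * P + y)
  shift = solve-∀
... | odd y′ = begin
  w (x * 2 ^ suc m + suc (2 * y′))  ≡⟨ cong w (shift x (2 ^ m) y′) ⟩
  w (suc (2 * (x * 2 ^ m + y′)))    ≡⟨ w-odd (x * 2 ^ m + y′) ⟩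
  suc (w (x * 2 ^ m + y′))          ≡⟨ cong suc (w-concat m x y′ (*-cancelˡ-< 2 y′ (2 ^ m) (<-trans (n<1+n _) y<2P))) ⟩
  suc (w x + w y′)                  ≡⟨ sym (+-suc (w x) (w y′)) ⟩
  w x + suc (w y′)                  ≡⟨ cong (w x +_) (sym (w-odd y′)) ⟩
  w x + w (suc (2 * y′))            ∎
  where
  open ≡-Reasoning
  shift : ∀ x P y → x * (2 * P) + suc (2 * y) ≡ suc (2 * (x * P + y))
  shift = solve-∀

w-complement : ∀ k n c → suc (n + c) ≡ 2 ^ k → w n + w c ≡ k
w-complement zero    zero    zero    _  = refl
w-complement zero    zero    (suc c) ()
w-complement zero    (suc n) c       ()
w-complement (suc k) n c n+c+1≡2P with parity n | parity c
... | even x | even y = contradiction (sym (trans (cong suc (*-distribˡ-+ 2 x y)) n+c+1≡2P))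
                                      (even≢odd (2 ^ k) (x + y))
... | odd x  | odd y  = contradiction (sym (trans (sym (oddSum x y)) n+c+1≡2P)) (even≢odd (2 ^ k) (suc (x + y)))
  where
  oddSum : ∀ x y → suc (suc (2 * x) + suc (2 * y)) ≡ suc (2 * suc (x + y))
  oddSum = solve-∀
... | even x | odd y  = begin
  w (2 * x) + w (suc (2 * y))  ≡⟨ cong₂ _+_ (w-even x) (w-odd y) ⟩
  w x + suc (w y)              ≡⟨ +-suc (w x) (w y) ⟩
  suc (w x + w y)              ≡⟨ cong suc (w-complement k x y (*-cancelˡ-≡ _ _ 2 (trans (halve x y) n+c+1≡2P))) ⟩
  suc k                        ∎
  where
  open ≡-Reasoning
  halve : ∀ x y → 2 * suc (x + y) ≡ suc (2 * x + suc (2 * y))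
  halve = solve-∀
... | odd x  | even y = begin
  w (suc (2 * x)) + w (2 * y)  ≡⟨ cong₂ _+_ (w-odd x) (w-even y) ⟩
  suc (w x + w y)              ≡⟨ cong suc (w-complement k x y (*-cancelˡ-≡ _ _ 2 (trans (halve x y) n+c+1≡2P))) ⟩
  suc k                        ∎
  where
  open ≡-Reasoning
  halve : ∀ x y → 2 * suc (x + y) ≡ suc (suc (2 * x) + 2 * y)
  halve = solve-∀

-- Part (1): the complement identity |S_{t,k}| + countCirc t k = 2^k

modℕ-% : ∀ a d .{{_ : NonZero d}} → modℕ a d ≡ a % d
modℕ-% a (suc d) = refl

%-absorbˡ : ∀ m n d .{{_ : NonZero d}} → (m % d + n) % d ≡ (m + n) % d
%-absorbˡ m n d = begin
  (m % d + n) % d              ≡⟨ %-distribˡ-+ (m % d) n d ⟩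
  (m % d % d + n % d) % d      ≡⟨ cong (λ r → (r + n % d) % d) (m%n%n≡m%n m d) ⟩
  (m % d + n % d) % d          ≡⟨ sym (%-distribˡ-+ m n d) ⟩
  (m + n) % d                  ∎
  where open ≡-Reasoning

+-<-complement : ∀ {a n k} x → a + n ≡ k → (a + x < k) ⇔ (¬ (n ≤ x))
+-<-complement {a} {n} x refl =
  mk⇔ (λ a+x<a+n → <⇒≱ (+-cancelˡ-< a x n a+x<a+n)) (λ n≰x → +-monoʳ-< a (≰⇒> n≰x))

module Complement (k t : ℕ) (t<d : t < M k) where

  d : ℕ
  d = M k

  instance
    d≢0 : NonZero d
    d≢0 = >-nonZero (≤-trans (s≤s z≤n) t<d)

  2^k≡1+d : 2 ^ k ≡ suc d
  2^k≡1+d = trans (sym (m∸n+n≡m (m^n>0 2 k))) (+-comm d 1)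

  partner : ℕ → ℕ
  partner a = (t + (d ∸ a)) % d

  partner-sum : ∀ a → a ≤ d → (a + partner a) % d ≡ t
  partner-sum a a≤d = begin
    (a + partner a) % d         ≡⟨ cong (_% d) (+-comm a (partner a)) ⟩
    (partner a + a) % d         ≡⟨ %-absorbˡ (t + (d ∸ a)) a d ⟩
    (t + (d ∸ a) + a) % d       ≡⟨ cong (_% d) (trans (+-assoc t (d ∸ a) a) (cong (t +_) (m∸n+n≡m a≤d))) ⟩
    (t + d) % d                 ≡⟨ [m+n]%n≡m%n t d ⟩
    t % d                       ≡⟨ m<n⇒m%n≡m t<d ⟩
    t                           ∎
    where open ≡-Reasoning

  partner-unique : ∀ a b → a ≤ d → b < d → (a + b) % d ≡ t → b ≡ partner a
  partner-unique a b a≤d b<d a+b≡t = begin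
    b                           ≡⟨ sym (m<n⇒m%n≡m b<d) ⟩
    b % d                       ≡⟨ sym ([m+n]%n≡m%n b d) ⟩
    (b + d) % d                 ≡⟨ cong (λ n → (b + n) % d) (sym (m∸n+n≡m a≤d)) ⟩
    (b + ((d ∸ a) + a)) % d     ≡⟨ cong (_% d) (regroup b (d ∸ a) a) ⟩
    (a + b + (d ∸ a)) % d       ≡⟨ sym (%-absorbˡ (a + b) (d ∸ a) d) ⟩
    ((a + b) % d + (d ∸ a)) % d ≡⟨ cong (λ r → (r + (d ∸ a)) % d) a+b≡t ⟩
    partner a                   ∎
    where
    open ≡-Reasoning
    regroup : ∀ b c a → b + (c + a) ≡ a + b + c
    regroup = solve-∀

  -- In S_{t,k}, each first coordinate a < d has only its partner as possible second coordinate.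
  sizeS-as-sum : sizeS t k ≡ ∑[ a < d ] 𝟙 (w a + w (partner a) <? k)
  sizeS-as-sum = trans (count-grid inS? d d) (∑-cong d row)
    where
    inS? : Decidable (λ (p : ℕ × ℕ) → (modℕ (proj₁ p + proj₂ p) d ≡ t) × (w (proj₁ p) + w (proj₂ p) < k))
    inS? p = (modℕ (proj₁ p + proj₂ p) d ≟ t) ×-dec (w (proj₁ p) + w (proj₂ p) <? k)
    row : ∀ a → a < d → ∑[ b < d ] 𝟙 (inS? (a , b)) ≡ 𝟙 (w a + w (partner a) <? k)
    row a a<d = trans (∑-single d (partner a) _ (m%n<n _ d) off-partner)
      (𝟙-cong (inS? (a , partner a)) (_ <? k)
        (mk⇔ proj₂ (λ small → trans (modℕ-% (a + partner a) d) (partner-sum a (<⇒≤ a<d)) , small)))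
      where
      off-partner : ∀ b → b < d → b ≢ partner a → 𝟙 (inS? (a , b)) ≡ 0
      off-partner b b<d b≢partner = 𝟙-no (inS? (a , b)) λ (a+b≡t , _) →
        b≢partner (partner-unique a b (<⇒≤ a<d) b<d (trans (sym (modℕ-% (a + b) d)) a+b≡t))

  -- n = 0 always counts; the remaining n run over 1, …, d.
  countCirc-as-sum : countCirc t k ≡ suc (∑[ i < d ] 𝟙 (w (suc i) ≤? w (⊕ k (suc i) t)))
  countCirc-as-sum = begin
    countCirc t k                                         ≡⟨ count-upTo (λ n → w n ≤? w (⊕ k n t)) (2 ^ k) ⟩
    ∑[ n < 2 ^ k ] 𝟙 (w n ≤? w (⊕ k n t))                 ≡⟨ cong (λ N → ∑[ n < N ] 𝟙 (w n ≤? w (⊕ k n t))) 2^k≡1+d ⟩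
    𝟙 (w 0 ≤? w (⊕ k 0 t)) + ∑[ i < d ] 𝟙 (w (suc i) ≤? w (⊕ k (suc i) t))
      ≡⟨ cong (_+ ∑[ i < d ] 𝟙 (w (suc i) ≤? w (⊕ k (suc i) t))) (𝟙-yes (w 0 ≤? w (⊕ k 0 t)) z≤n) ⟩
    suc (∑[ i < d ] 𝟙 (w (suc i) ≤? w (⊕ k (suc i) t)))  ∎
    where open ≡-Reasoning

  -- For 1 ≤ n ≤ d, the pair (d − n, n ⊕ t) lies in S_{t,k} exactly when w(n ⊕ t) < w(n):
  -- d − n is the k-bit complement of n and n ⊕ t is the partner of d − n.
  complementary : ∀ n → n ≤ d → 𝟙 (w (d ∸ n) + w (partner (d ∸ n)) <? k) + 𝟙 (w n ≤? w (⊕ k n t)) ≡ 1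
  complementary n n≤d = 𝟙-compl (_ <? k) (w n ≤? w (⊕ k n t))
    (subst (λ x → (w a + w x < k) ⇔ (¬ (w n ≤ w (⊕ k n t)))) (sym partner≡n⊕t)
           (+-<-complement (w (⊕ k n t)) (w-complement k a n bits)))
    where
    a : ℕ
    a = d ∸ n
    bits : suc (a + n) ≡ 2 ^ k
    bits = trans (cong suc (m∸n+n≡m n≤d)) (sym 2^k≡1+d)
    partner≡n⊕t : partner a ≡ ⊕ k n t
    partner≡n⊕t = begin
      (t + (d ∸ (d ∸ n))) % d   ≡⟨ cong (λ x → (t + x) % d) (m∸[m∸n]≡n n≤d) ⟩
      (t + n) % d               ≡⟨ cong (_% d) (+-comm t n) ⟩
      (n + t) % d               ≡⟨ sym (modℕ-% (n + t) d) ⟩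
      ⊕ k n t                   ∎
      where open ≡-Reasoning

  complement-count : sizeS t k + countCirc t k ≡ 2 ^ k
  complement-count = begin
    sizeS t k + countCirc t k
      ≡⟨ cong₂ _+_ (trans sizeS-as-sum (∑-reverse d g)) countCirc-as-sum ⟩
    ∑[ i < d ] g (d ∸ suc i) + suc (∑[ i < d ] h (suc i))
      ≡⟨ +-suc _ _ ⟩
    suc (∑[ i < d ] g (d ∸ suc i) + ∑[ i < d ] h (suc i))
      ≡⟨ cong suc (sym (∑-+ d (λ i → g (d ∸ suc i)) (h ∘ suc))) ⟩
    suc (∑[ i < d ] (g (d ∸ suc i) + h (suc i)))
      ≡⟨ cong suc (∑-cong d (λ i i<d → complementary (suc i) i<d)) ⟩
    suc (∑[ i < d ] 1)
      ≡⟨ cong suc (trans (∑-const d 1) (*-identityʳ d)) ⟩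
    suc d
      ≡⟨ sym 2^k≡1+d ⟩
    2 ^ k ∎
    where
    open ≡-Reasoning
    g h : ℕ → ℕ
    g a = 𝟙 (w a + w (partner a) <? k)
    h n = 𝟙 (w n ≤? w (⊕ k n t))

2^k≡half+half : ∀ k → k ≥ 1 → 2 ^ k ≡ 2 ^ (k ∸ 1) + 2 ^ (k ∸ 1)
2^k≡half+half (suc k) _ = cong (2 ^ k +_) (+-identityʳ (2 ^ k))

≤-half⇔ : ∀ {x y h} → x + y ≡ h + h → (x ≤ h) ⇔ (h ≤ y)
≤-half⇔ {x} {y} {h} x+y≡2h = mk⇔
  (λ x≤h → +-cancelˡ-≤ h h y (subst (_≤ h + y) x+y≡2h (+-monoˡ-≤ y x≤h)))
  (λ h≤y → +-cancelʳ-≤ h x h (subst (x + h ≤_) x+y≡2h (+-monoʳ-≤ x h≤y)))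

-- The hypothesis 1 ≤ t ≤ 2^k − 2 of (i) and (ii) says t is a nonzero residue mod 2^k − 1.
nonzero-residue : ∀ N t → 1 ≤ t → t ≤ N ∸ 2 → t < N ∸ 1
nonzero-residue (suc (suc N)) t _ t≤N = s≤s t≤N
nonzero-residue zero          t 1≤t t≤0 = contradiction (≤-trans 1≤t t≤0) λ ()
nonzero-residue (suc zero)    t 1≤t t≤0 = contradiction (≤-trans 1≤t t≤0) λ ()

-- (i) ⇔ (ii): the two counts add up to 2^k = 2^{k−1} + 2^{k−1}.
I⇔II : StmtI ⇔ StmtII
I⇔II = mk⇔ (λ I k k≥1 t 1≤t t≤ → Equivalence.to   (half k k≥1 t 1≤t t≤) (I  k k≥1 t 1≤t t≤))
           (λ II k k≥1 t 1≤t t≤ → Equivalence.from (half k k≥1 t 1≤t t≤) (II k k≥1 t 1≤t t≤))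
  where
  half : ∀ k → k ≥ 1 → ∀ t → 1 ≤ t → t ≤ 2 ^ k ∸ 2 → (sizeS t k ≤ 2 ^ (k ∸ 1)) ⇔ (2 ^ (k ∸ 1) ≤ countCirc t k)
  half k k≥1 t 1≤t t≤ = ≤-half⇔ (trans (Complement.complement-count k t (nonzero-residue (2 ^ k) t 1≤t t≤))
                                       (2^k≡half+half k k≥1))

-- Part (2), first direction: a density above 1/2 gives a majority in every [0, 2^k)

countBelow-as-sum : ∀ t N → countBelow t N ≡ ∑[ n < N ] 𝟙 (w n ≤? w (n + t))
countBelow-as-sum t N = count-upTo (λ n → w n ≤? w (n + t)) N

countBelow-mono : ∀ t {M N} → M ≤ N → countBelow t M ≤ countBelow t N
countBelow-mono t {M} {N} M≤N = begin
  countBelow t M                            ≡⟨ countBelow-as-sum t M ⟩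
  ∑[ n < M ] 𝟙 (w n ≤? w (n + t))           ≤⟨ ∑-prefix M (N ∸ M) _ ⟩
  ∑[ n < M + (N ∸ M) ] 𝟙 (w n ≤? w (n + t)) ≡⟨ cong (λ L → ∑[ n < L ] 𝟙 (w n ≤? w (n + t))) (m+[n∸m]≡n M≤N) ⟩
  ∑[ n < N ] 𝟙 (w n ≤? w (n + t))           ≡⟨ sym (countBelow-as-sum t N) ⟩
  countBelow t N                            ∎
  where open ≤-Reasoning

-- A position r of block q (in blocks of length 2^k) that counts also counts in block 0:
-- the high part q contributes w(q) before adding t and at most w(q) after.
block-good⇒good : ∀ t k q r → r < 2 ^ k → w (q * 2 ^ k + r) ≤ w (q * 2 ^ k + r + t) → w r ≤ w (r + t)
block-good⇒good t k q r r<P good = +-cancelˡ-≤ (w q) (w r) (w (r + t)) (begin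
  w q + w r                       ≡⟨ sym (w-concat k q r r<P) ⟩
  w (q * 2 ^ k + r)               ≤⟨ good ⟩
  w (q * 2 ^ k + r + t)           ≡⟨ cong w (+-assoc (q * 2 ^ k) r t) ⟩
  w (q * 2 ^ k + (r + t))         ≤⟨ w-subadditive (q * 2 ^ k) (r + t) ⟩
  w (q * 2 ^ k) + w (r + t)       ≡⟨ cong (λ n → w n + w (r + t)) (sym (+-identityʳ (q * 2 ^ k))) ⟩
  w (q * 2 ^ k + 0) + w (r + t)   ≡⟨ cong (_+ w (r + t)) (trans (w-concat k q 0 (m^n>0 2 k)) (+-identityʳ (w q))) ⟩
  w q + w (r + t)                 ∎)
  where open ≤-Reasoning

block-count-bound : ∀ t k Q → countBelow t (Q * 2 ^ k) ≤ Q * countBelow t (2 ^ k)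
block-count-bound t k Q = begin
  countBelow t (Q * 2 ^ k)                              ≡⟨ countBelow-as-sum t (Q * 2 ^ k) ⟩
  ∑ (Q * 2 ^ k) good                                    ≡⟨ ∑-blocks Q (2 ^ k) good ⟩
  ∑[ q < Q ] ∑[ r < 2 ^ k ] good (q * 2 ^ k + r)        ≤⟨ ∑-mono Q (λ q _ → ∑-mono (2 ^ k) (λ r r<P →
                                                             𝟙-mono (_ ≤? _) (_ ≤? _) (block-good⇒good t k q r r<P))) ⟩
  ∑[ q < Q ] ∑ (2 ^ k) good                             ≡⟨ ∑-const Q _ ⟩
  Q * ∑ (2 ^ k) good                                    ≡⟨ cong (Q *_) (sym (countBelow-as-sum t (2 ^ k))) ⟩
  Q * countBelow t (2 ^ k)                              ∎
  where
  open ≤-Reasoning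
  good : ℕ → ℕ
  good n = 𝟙 (w n ≤? w (n + t))

-- Testing the density bound on N = Q·2^k with Q large and using block-count-bound.
density⇒majority : ∀ t → DensityGtHalf t → ∀ k → 2 ^ k < 2 * countBelow t (2 ^ k)
density⇒majority t (a , b , 2a>b , N₀ , bound) k = *-cancelˡ-< b P (2 * A) (begin-strict
  b * P          <⟨ *-monoˡ-< P 2a>b ⟩
  2 * a * P      ≡⟨ *-assoc 2 a P ⟩
  2 * (a * P)    ≤⟨ *-monoʳ-≤ 2 aP≤bA ⟩
  2 * (b * A)    ≡⟨ *-comm-middle 2 b A ⟩
  b * (2 * A)    ∎)
  where
  open ≤-Reasoning
  P A Q : ℕ
  P = 2 ^ k
  A = countBelow t P
  Q = suc N₀
  instance
    P≢0 : NonZero P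
    P≢0 = m^n≢0 2 k
  *-comm-middle : ∀ x y z → x * (y * z) ≡ y * (x * z)
  *-comm-middle = solve-∀
  aP≤bA : a * P ≤ b * A
  aP≤bA = *-cancelˡ-≤ Q (begin
    Q * (a * P)              ≡⟨ *-comm-middle Q a P ⟩
    a * (Q * P)              ≤⟨ bound (Q * P) (≤-trans (n≤1+n N₀) (m≤m*n Q P)) ⟩
    b * countBelow t (Q * P) ≤⟨ *-monoʳ-≤ b (block-count-bound t k Q) ⟩
    b * (Q * A)              ≡⟨ *-comm-middle b Q A ⟩
    Q * (b * A)              ∎)

majority⇔ : ∀ k A → k ≥ 1 → (2 ^ (k ∸ 1) < A) ⇔ (2 ^ k < 2 * A)
majority⇔ (suc k) A _ = mk⇔ (*-monoʳ-< 2) (*-cancelˡ-< 2 (2 ^ k) A)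

III⇒IV : StmtIII → StmtIV
III⇒IV III k t k≥1 _ = Equivalence.from (majority⇔ k (countBelow t (2 ^ k)) k≥1) (density⇒majority t (III t) k)

-- Part (2), second direction, abstractly: averages of a sequence governed by trailing ones
--
-- H j q is the value of block q; the laws below say that H j q = h(j + ν(q)) where ν(q) is
-- the number of trailing ones of q and h = H · 0 is antitone and constant from J on.
-- Under these laws the average of the first Q blocks is never below the average of the
-- first 2^L blocks as soon as j + L ≥ J.

module TrailingOnes
  (H : ℕ → ℕ → ℕ) (J : ℕ)
  (H-even     : ∀ j q → H j (2 * q) ≡ H j 0)
  (H-odd      : ∀ j q → H j (suc (2 * q)) ≡ H (suc j) q)
  (H-antitone : ∀ j → H (suc j) 0 ≤ H j 0)
  (H-stable   : ∀ j → J ≤ j → H (suc j) 0 ≡ H j 0)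
  where

  H-max : ∀ q j → H j q ≤ H j 0
  H-max = binary-ind _ (λ j → ≤-refl) (λ q _ j → ≤-reflexive (H-even j q)) step-odd
    where
    step-odd : ∀ q → (∀ j → H j q ≤ H j 0) → ∀ j → H j (suc (2 * q)) ≤ H j 0
    step-odd q ih j = ≤-trans (≤-reflexive (H-odd j q)) (≤-trans (ih (suc j)) (H-antitone j))

  H-const : ∀ q j → J ≤ j → H j q ≡ H j 0
  H-const = binary-ind _ (λ j _ → refl) (λ q _ j _ → H-even j q) step-odd
    where
    step-odd : ∀ q → (∀ j → J ≤ j → H j q ≡ H j 0) → ∀ j → J ≤ j → H j (suc (2 * q)) ≡ H j 0
    step-odd q ih j J≤j = trans (H-odd j q) (trans (ih (suc j) (m≤n⇒m≤1+n J≤j)) (H-stable j J≤j))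

  S : ℕ → ℕ → ℕ
  S j Q = ∑[ q < Q ] H j q

  S-even : ∀ j Q → S j (2 * Q) ≡ Q * H j 0 + S (suc j) Q
  S-even j Q = trans (∑-parity Q (H j))
    (cong₂ _+_ (trans (∑-cong Q (λ q _ → H-even j q)) (∑-const Q (H j 0))) (∑-cong Q (λ q _ → H-odd j q)))

  S-odd : ∀ j Q → S j (suc (2 * Q)) ≡ S j (2 * Q) + H j 0
  S-odd j Q = trans (∑-snoc (2 * Q) (H j)) (cong (S j (2 * Q) +_) (H-even j Q))

  S-max : ∀ j Q → S j Q ≤ Q * H j 0
  S-max j Q = ≤-trans (∑-mono Q (λ q _ → H-max q j)) (≤-reflexive (∑-const Q (H j 0)))

  S-const : ∀ j Q → J ≤ j → S j Q ≡ Q * H j 0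
  S-const j Q J≤j = trans (∑-cong Q (λ q _ → H-const q j J≤j)) (∑-const Q (H j 0))

  -- Doubling step for an even number of blocks: split both totals into even and odd blocks.
  average-even : ∀ L j Q → Q * S (suc j) (2 ^ L) ≤ 2 ^ L * S (suc j) Q →
                 2 * Q * S j (2 ^ suc L) ≤ 2 ^ suc L * S j (2 * Q)
  average-even L j Q ih = begin
    2 * Q * S j (2 * K)                          ≡⟨ cong (2 * Q *_) (S-even j K) ⟩
    2 * Q * (K * h + S (suc j) K)                ≡⟨ expand Q K h (S (suc j) K) ⟩
    2 * (Q * (K * h)) + 2 * (Q * S (suc j) K)    ≤⟨ +-monoʳ-≤ (2 * (Q * (K * h))) (*-monoʳ-≤ 2 ih) ⟩
    2 * (Q * (K * h)) + 2 * (K * S (suc j) Q)    ≡⟨ collect Q K h (S (suc j) Q) ⟩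
    2 * K * (Q * h + S (suc j) Q)                ≡⟨ cong (2 * K *_) (sym (S-even j Q)) ⟩
    2 * K * S j (2 * Q)                          ∎
    where
    open ≤-Reasoning
    K h : ℕ
    K = 2 ^ L
    h = H j 0
    expand : ∀ Q K h T → 2 * Q * (K * h + T) ≡ 2 * (Q * (K * h)) + 2 * (Q * T)
    expand = solve-∀
    collect : ∀ Q K h U → 2 * (Q * (K * h)) + 2 * (K * U) ≡ 2 * K * (Q * h + U)
    collect = solve-∀

  -- The extra last block of an odd number of blocks is the maximal block H j 0.
  average-odd : ∀ L j Q → 2 * Q * S j (2 ^ suc L) ≤ 2 ^ suc L * S j (2 * Q) →
                suc (2 * Q) * S j (2 ^ suc L) ≤ 2 ^ suc L * S j (suc (2 * Q))
  average-odd L j Q even-bound = begin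
    T + 2 * Q * T                       ≤⟨ +-mono-≤ (S-max j (2 * K)) even-bound ⟩
    2 * K * h + 2 * K * S j (2 * Q)     ≡⟨ +-comm (2 * K * h) _ ⟩
    2 * K * S j (2 * Q) + 2 * K * h     ≡⟨ sym (*-distribˡ-+ (2 * K) (S j (2 * Q)) h) ⟩
    2 * K * (S j (2 * Q) + h)           ≡⟨ cong (2 * K *_) (sym (S-odd j Q)) ⟩
    2 * K * S j (suc (2 * Q))           ∎
    where
    open ≤-Reasoning
    K h T : ℕ
    K = 2 ^ L
    h = H j 0
    T = S j (2 * K)

  prefix-average : ∀ L j Q → J ≤ j + L → Q * S j (2 ^ L) ≤ 2 ^ L * S j Q
  prefix-average zero j Q J≤j+0 = ≤-reflexive (begin
    Q * (H j 0 + 0)   ≡⟨ cong (Q *_) (+-identityʳ (H j 0)) ⟩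
    Q * H j 0         ≡⟨ sym (S-const j Q (subst (J ≤_) (+-identityʳ j) J≤j+0)) ⟩
    S j Q             ≡⟨ sym (+-identityʳ (S j Q)) ⟩
    S j Q + 0         ∎)
    where open ≡-Reasoning
  prefix-average (suc L) j Q J≤j+1+L with parity Q
  ... | even Q′ = average-even L j Q′ (prefix-average L (suc j) Q′ (subst (J ≤_) (+-suc j L) J≤j+1+L))
  ... | odd Q′  = average-odd L j Q′
                    (average-even L j Q′ (prefix-average L (suc j) Q′ (subst (J ≤_) (+-suc j L) J≤j+1+L)))

-- Part (2), second direction, concretely: the carry analysis for w(n + t) ≥ w(n)

≤-cong⇔ : ∀ {a a′ b b′} → a ≡ a′ → b ≡ b′ → (a ≤ b) ⇔ (a′ ≤ b′)
≤-cong⇔ refl refl = ⇔-refl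

+-cancel⇔ : ∀ x {a b} → (x + a ≤ x + b) ⇔ (a ≤ b)
+-cancel⇔ x = mk⇔ (+-cancelˡ-≤ x _ _) (+-monoʳ-≤ x)

-- Write n = q·P + r with P = 2^m > t. Adding t either stays inside the block (w(n) and w(n+t)
-- share the high part w(q)) or carries once into the block number (q becomes q + 1).
module CarryAnalysis (t m : ℕ) (t<P : t < 2 ^ m) where

  P : ℕ
  P = 2 ^ m

  -- Position r of block q counts, with a penalty j charged if r + t carries into the block number.
  -- For j = 0 this is literally the condition w(qP + r) ≤ w(qP + r + t).
  Good : ℕ → ℕ → ℕ → Set
  Good j q r = j * 𝟙 (P ≤? r + t) + w (q * P + r) ≤ w (q * P + r + t)

  Good? : ∀ j q r → Dec (Good j q r)
  Good? j q r = _ ≤? _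

  data CarryCase (r : ℕ) : Set where
    no-carry : r + t < P → CarryCase r
    carry    : ∀ s → s < P → r + t ≡ P + s → CarryCase r

  carry-case : ∀ r → r < P → CarryCase r
  carry-case r r<P with P ≤? r + t
  ... | no  P≰r+t = no-carry (≰⇒> P≰r+t)
  ... | yes P≤r+t = carry (r + t ∸ P) s<P (sym (m+[n∸m]≡n P≤r+t))
    where
    s<P : r + t ∸ P < P
    s<P = +-cancelˡ-< P (r + t ∸ P) P (subst (_< P + P) (sym (m+[n∸m]≡n P≤r+t)) (+-mono-< r<P t<P))

  good-no-carry : ∀ j q r → r + t < P → Good j q r ⇔ (w r ≤ w (r + t))
  good-no-carry j q r r+t<P = ⇔-trans (≤-cong⇔ before after) (+-cancel⇔ (w q))
    where
    before : j * 𝟙 (P ≤? r + t) + w (q * P + r) ≡ w q + w r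
    before = cong₂ _+_ (trans (cong (j *_) (𝟙-no (P ≤? r + t) (<⇒≱ r+t<P))) (*-zeroʳ j))
                       (w-concat m q r (≤-<-trans (m≤m+n r t) r+t<P))
    after : w (q * P + r + t) ≡ w q + w (r + t)
    after = trans (cong w (+-assoc (q * P) r t)) (w-concat m q (r + t) r+t<P)

  good-no-carry-indep : ∀ j q j′ q′ r → r + t < P → Good j q r ⇔ Good j′ q′ r
  good-no-carry-indep j q j′ q′ r r+t<P = ⇔-trans (good-no-carry j q r r+t<P) (⇔-sym (good-no-carry j′ q′ r r+t<P))

  good-carry : ∀ j q r s → r < P → s < P → r + t ≡ P + s → Good j q r ⇔ (j + w q + w r ≤ w (suc q) + w s)
  good-carry j q r s r<P s<P r+t≡P+s = ≤-cong⇔ before after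
    where
    before : j * 𝟙 (P ≤? r + t) + w (q * P + r) ≡ j + w q + w r
    before = trans (cong₂ _+_ (trans (cong (j *_) (𝟙-yes (P ≤? r + t) (subst (P ≤_) (sym r+t≡P+s) (m≤m+n P s))))
                                     (*-identityʳ j))
                              (w-concat m q r r<P))
                   (sym (+-assoc j (w q) (w r)))
    after : w (q * P + r + t) ≡ w (suc q) + w s
    after = trans (cong w (trans (+-assoc (q * P) r t) (trans (cong (q * P +_) r+t≡P+s) (regroup (q * P) P s))))
                  (w-concat m (suc q) s s<P)
      where
      regroup : ∀ x P s → x + (P + s) ≡ P + x + s
      regroup = solve-∀

  -- Even block numbers: the carry turns the last 0 of q into a 1, exactly as for q = 0.
  good-even : ∀ j q r → r < P → Good j (2 * q) r ⇔ Good j 0 r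
  good-even j q r r<P with carry-case r r<P
  ... | no-carry r+t<P        = good-no-carry-indep j (2 * q) j 0 r r+t<P
  ... | carry s s<P r+t≡P+s = ⇔-trans (good-carry j (2 * q) r s r<P s<P r+t≡P+s)
                                (⇔-trans arith (⇔-sym (good-carry j 0 r s r<P s<P r+t≡P+s)))
    where
    arith : (j + w (2 * q) + w r ≤ w (suc (2 * q)) + w s) ⇔ (j + w 0 + w r ≤ w 1 + w s)
    arith = ⇔-trans (≤-cong⇔ (trans (cong (λ x → j + x + w r) (w-even q)) (shuffle j (w q) (w r)))
                              (trans (cong (_+ w s) (w-odd q)) (sym (+-suc (w q) (w s)))))
                    (⇔-trans (+-cancel⇔ (w q)) (≤-cong⇔ (cong (_+ w r) (sym (+-identityʳ j))) refl))
      where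
      shuffle : ∀ j x y → j + x + y ≡ x + (j + y)
      shuffle = solve-∀

  -- Odd block numbers: the carry clears a trailing 1 of q, which costs one more unit of penalty.
  good-odd : ∀ j q r → r < P → Good j (suc (2 * q)) r ⇔ Good (suc j) q r
  good-odd j q r r<P with carry-case r r<P
  ... | no-carry r+t<P        = good-no-carry-indep j (suc (2 * q)) (suc j) q r r+t<P
  ... | carry s s<P r+t≡P+s = ⇔-trans (good-carry j (suc (2 * q)) r s r<P s<P r+t≡P+s)
                                (⇔-trans arith (⇔-sym (good-carry (suc j) q r s r<P s<P r+t≡P+s)))
    where
    arith : (j + w (suc (2 * q)) + w r ≤ w (suc (suc (2 * q))) + w s) ⇔ (suc j + w q + w r ≤ w (suc q) + w s)
    arith = ≤-cong⇔ (cong (_+ w r) (trans (cong (j +_) (w-odd q)) (+-suc j (w q))))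
                    (cong (_+ w s) (trans (cong w (2[1+q] q)) (w-even (suc q))))
      where
      2[1+q] : ∀ q → suc (suc (2 * q)) ≡ 2 * suc q
      2[1+q] = solve-∀

  good-antitone : ∀ j r → r < P → Good (suc j) 0 r → Good j 0 r
  good-antitone j r r<P with carry-case r r<P
  ... | no-carry r+t<P        = Equivalence.to (good-no-carry-indep (suc j) 0 j 0 r r+t<P)
  ... | carry s s<P r+t≡P+s = Equivalence.from (good-carry j 0 r s r<P s<P r+t≡P+s)
                              ∘ ≤-trans (n≤1+n _) ∘ Equivalence.to (good-carry (suc j) 0 r s r<P s<P r+t≡P+s)

  -- A penalty above P forbids every carrying position, since then 1 + w(s) ≤ P.
  good-stable : ∀ j r → r < P → suc P ≤ j → Good (suc j) 0 r ⇔ Good j 0 r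
  good-stable j r r<P P<j with carry-case r r<P
  ... | no-carry r+t<P        = good-no-carry-indep (suc j) 0 j 0 r r+t<P
  ... | carry s s<P r+t≡P+s = mk⇔
    (λ good → contradiction (Equivalence.to (good-carry (suc j) 0 r s r<P s<P r+t≡P+s) good) (too-heavy (suc j) (m≤n⇒m≤1+n P<j)))
    (λ good → contradiction (Equivalence.to (good-carry j 0 r s r<P s<P r+t≡P+s) good) (too-heavy j P<j))
    where
    too-heavy : ∀ i → suc P ≤ i → ¬ (i + w 0 + w r ≤ w 1 + w s)
    too-heavy i P<i = <⇒≱ (begin-strict
      1 + w s       ≤⟨ s≤s (w≤id s) ⟩
      1 + s         ≤⟨ s<P ⟩
      P             <⟨ P<i ⟩
      i             ≤⟨ m≤m+n i 0 ⟩
      i + 0         ≤⟨ m≤m+n (i + 0) (w r) ⟩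
      i + 0 + w r   ∎)
      where open ≤-Reasoning

  H : ℕ → ℕ → ℕ
  H j q = ∑[ r < P ] 𝟙 (Good? j q r)

  H-even : ∀ j q → H j (2 * q) ≡ H j 0
  H-even j q = ∑-cong P (λ r r<P → 𝟙-cong (Good? j (2 * q) r) (Good? j 0 r) (good-even j q r r<P))

  H-odd : ∀ j q → H j (suc (2 * q)) ≡ H (suc j) q
  H-odd j q = ∑-cong P (λ r r<P → 𝟙-cong (Good? j (suc (2 * q)) r) (Good? (suc j) q r) (good-odd j q r r<P))

  H-antitone : ∀ j → H (suc j) 0 ≤ H j 0
  H-antitone j = ∑-mono P (λ r r<P → 𝟙-mono (Good? (suc j) 0 r) (Good? j 0 r) (good-antitone j r r<P))

  H-stable : ∀ j → suc P ≤ j → H (suc j) 0 ≡ H j 0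
  H-stable j P<j = ∑-cong P (λ r r<P → 𝟙-cong (Good? (suc j) 0 r) (Good? j 0 r) (good-stable j r r<P P<j))

  blocks-countBelow : ∀ Q → ∑[ q < Q ] H 0 q ≡ countBelow t (Q * P)
  blocks-countBelow Q = sym (trans (countBelow-as-sum t (Q * P)) (∑-blocks Q P (λ n → 𝟙 (w n ≤? w (n + t)))))

-- Part (2), second direction: from block averages to density

-- If on average a block of length P contains C/K > P/2 counted n, the density exceeds 1/2:
-- countBelow t N ≥ (2D+1)/(4D) · N for N ≥ (2D+1)P, where D = K·P.
density-from-blocks : ∀ t P K C .{{_ : NonZero P}} → K * P < 2 * C →
                      (∀ Q → Q * C ≤ K * countBelow t (Q * P)) → DensityGtHalf t
density-from-blocks t P K C D<2C averages = a , 4 * D , 4D<2a , a * P , bound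
  where
  D a : ℕ
  D = K * P
  a = 2 * D + 1
  4D<2a : 2 * a > 4 * D
  4D<2a = ≤-trans (n≤1+n _) (≤-reflexive (double D))
    where
    double : ∀ D → suc (suc (4 * D)) ≡ 2 * (2 * D + 1)
    double = solve-∀
  bound : ∀ N → N ≥ a * P → 4 * D * countBelow t N ≥ a * N
  bound N N≥aP = begin
    a * N                           ≡⟨ cong (a *_) N≡QP+R ⟩
    a * (Q * P + R)                 ≡⟨ *-distribˡ-+ a (Q * P) R ⟩
    a * (Q * P) + a * R             ≤⟨ +-monoʳ-≤ (a * (Q * P)) (≤-trans (*-monoʳ-≤ a (<⇒≤ (m%n<n N P))) (*-monoˡ-≤ P a≤Q)) ⟩
    a * (Q * P) + Q * P             ≡⟨ regroup D (Q * P) ⟩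
    suc D * (2 * (Q * P))           ≤⟨ *-monoˡ-≤ (2 * (Q * P)) D<2C ⟩
    2 * C * (2 * (Q * P))           ≡⟨ regroup′ P Q C ⟩
    4 * P * (Q * C)                 ≤⟨ *-monoʳ-≤ (4 * P) (averages Q) ⟩
    4 * P * (K * countBelow t (Q * P)) ≡⟨ regroup″ P K (countBelow t (Q * P)) ⟩
    4 * D * countBelow t (Q * P)    ≤⟨ *-monoʳ-≤ (4 * D) (countBelow-mono t (m≤m+n (Q * P) R)) ⟩
    4 * D * countBelow t (Q * P + R) ≡⟨ cong (λ n → 4 * D * countBelow t n) (sym N≡QP+R) ⟩
    4 * D * countBelow t N          ∎
    where
    open ≤-Reasoning
    Q R : ℕ
    Q = N / P
    R = N % P
    N≡QP+R : N ≡ Q * P + R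
    N≡QP+R = trans (m≡m%n+[m/n]*n N P) (+-comm R (Q * P))
    a≤Q : a ≤ Q
    a≤Q = subst (_≤ Q) (m*n/n≡m a P) (/-monoˡ-≤ P N≥aP)
    regroup : ∀ D x → (2 * D + 1) * x + x ≡ suc D * (2 * x)
    regroup = solve-∀
    regroup′ : ∀ P Q C → 2 * C * (2 * (Q * P)) ≡ 4 * P * (Q * C)
    regroup′ = solve-∀
    regroup″ : ∀ P K x → 4 * P * (K * x) ≡ 4 * (K * P) * x
    regroup″ = solve-∀

countBelow-zero : ∀ N → countBelow 0 N ≡ N
countBelow-zero N = begin
  countBelow 0 N                    ≡⟨ countBelow-as-sum 0 N ⟩
  ∑[ n < N ] 𝟙 (w n ≤? w (n + 0))   ≡⟨ ∑-cong N (λ n _ → 𝟙-yes (w n ≤? w (n + 0)) (≤-reflexive (cong w (sym (+-identityʳ n))))) ⟩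
  ∑[ n < N ] 1                      ≡⟨ ∑-const N 1 ⟩
  N * 1                             ≡⟨ *-identityʳ N ⟩
  N                                 ∎
  where open ≡-Reasoning

n<2^n : ∀ n → n < 2 ^ n
n<2^n zero    = s≤s z≤n
n<2^n (suc n) = begin-strict
  suc n           ≡⟨ +-comm 1 n ⟩
  n + 1           <⟨ +-mono-<-≤ (n<2^n n) (m^n>0 2 n) ⟩
  2 ^ n + 2 ^ n   ≡⟨ cong (2 ^ n +_) (sym (+-identityʳ (2 ^ n))) ⟩
  2 ^ suc n       ∎
  where open ≤-Reasoning

-- For t ≥ 1 take blocks of length P = 2^t > t, so at most one carry enters the block number;
-- (iv) at scale 2^{P+1}·P bounds the average over the first 2^{P+1} blocks, and
-- prefix-average transfers this bound to every initial run of blocks.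
IV⇒III : StmtIV → StmtIII
IV⇒III IV zero        = 1 , 1 , s≤s (s≤s z≤n) , 0 , λ N _ → ≤-reflexive (cong (_+ 0) (sym (countBelow-zero N)))
IV⇒III IV t@(suc _) = density-from-blocks t P K C KP<2C averages
  where
  open CarryAnalysis t t (n<2^n t)
  open TrailingOnes H (suc P) H-even H-odd H-antitone H-stable
  instance
    P≢0 : NonZero P
    P≢0 = m^n≢0 2 t
  K C : ℕ
  K = 2 ^ suc P
  C = countBelow t (K * P)
  KP<2C : K * P < 2 * C
  KP<2C = subst (λ N → N < 2 * countBelow t N) (^-distribˡ-+-* 2 (suc P) t)
    (Equivalence.to (majority⇔ (suc P + t) _ (s≤s z≤n)) (IV (suc P + t) t (s≤s z≤n) (s≤s z≤n)))
  averages : ∀ Q → Q * C ≤ K * countBelow t (Q * P)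
  averages Q = subst₂ (λ x y → Q * x ≤ K * y) (blocks-countBelow K) (blocks-countBelow Q)
    (prefix-average (suc P) 0 Q ≤-refl)

proposition3 : (StmtI ⇔ StmtII) × (StmtIII ⇔ StmtIV)
proposition3 = I⇔II , mk⇔ III⇒IV IV⇒III
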